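{- Let $\epsilon,\beta\in[\tfrac23,1)$ with $\beta>\epsilon$, and let $k,n,m\geq 1$ be integers with $m\geq kn$ and $n\geq \frac{1}{1-\beta}$. Let $G$ and $H$ be connected graphs with $m$ and $n$ vertices respectively, such that every $\beta$-separation of $G$ has order at least $k$. Then every $\epsilon$-separation of $G\square H$ has order at least $(1-\frac{\epsilon}{\beta})kn$.
   Context: All graphs are finite and simple. For a graph $G$ and $\epsilon\in[\frac23,1)$, a partition $(A,S,B)$ of $V(G)$ is an $\epsilon$-separation if $1\leq |A|,|B|\leq \epsilon|V(G)|$ and there is no edge between $A$ and $B$; its order is $|S|$. The cartesian product $G\square H$ has vertex set $V(G)\times V(H)$, with $(a,v)(b,u)$ an edge iff either $ab\in E(G)$ and $u=v$, or $uv\in E(H)$ and $a=b$.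
   Formalization: The parameters $\epsilon$ and $\beta$ range over the rationals in $[\tfrac23,1)$. -}

module Defs where

open import Data.Nat as ℕ using (ℕ; zero; suc)
import Data.Integer
open Data.Integer using (+_)
open import Data.Fin as Fin using (Fin; remQuot)
open import Data.Fin.Properties using () renaming (_≟_ to _≟ᶠ_)
open import Data.Product using (_×_; _,_; proj₁; proj₂)
open import Data.Sum using (_⊎_; inj₁; inj₂)
open import Data.Empty using (⊥)
open import Relation.Nullary using (¬_; yes; no)
open import Relation.Binary.PropositionalEquality using (_≡_; refl; sym)
open import Data.Rational as ℚ using (ℚ; 0ℚ; 1ℚ; _<_; _≤_; _/_; -_; _-_)
import Data.Rational.Properties as ℚP

record Graph (n : ℕ) : Set₁ where
  field
    E       : Fin n → Fin n → Set
    E-sym   : ∀ {x y} → E x y → E y x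
    E-irr   : ∀ {x} → ¬ E x x
open Graph public

data Walk {n : ℕ} (G : Graph n) : Fin n → Fin n → Set where
  here : ∀ {u} → Walk G u u
  step : ∀ {u w v} → E G u w → Walk G w v → Walk G u v

Connected : ∀ {n} → Graph n → Set
Connected G = ∀ u v → Walk G u v

-- Cartesian product G □ H on V(G) × V(H), encoded as Fin (m * n)
-- via Data.Fin.remQuot (a bijection Fin (m * n) ≃ Fin m × Fin n).

_□_ : ∀ {m n} → Graph m → Graph n → Graph (m ℕ.* n)
_□_ {m} {n} G H = record { E = PE ; E-sym = sy ; E-irr = ir }
  where
  π₁ : Fin (m ℕ.* n) → Fin m
  π₁ x = proj₁ (remQuot {m} n x)
  π₂ : Fin (m ℕ.* n) → Fin n
  π₂ x = proj₂ (remQuot {m} n x)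
  PE : Fin (m ℕ.* n) → Fin (m ℕ.* n) → Set
  PE x y = (E G (π₁ x) (π₁ y) × π₂ x ≡ π₂ y)
         ⊎ (E H (π₂ x) (π₂ y) × π₁ x ≡ π₁ y)
  sy : ∀ {x y} → PE x y → PE y x
  sy (inj₁ (e , p)) = inj₁ (E-sym G e , sym p)
  sy (inj₂ (e , p)) = inj₂ (E-sym H e , sym p)
  ir : ∀ {x} → ¬ PE x x
  ir (inj₁ (e , _)) = E-irr G e
  ir (inj₂ (e , _)) = E-irr H e

data Side : Set where
  𝔸 𝕊 𝔹 : Side

sameSide : Side → Side → ℕ
sameSide 𝔸 𝔸 = 1
sameSide 𝕊 𝕊 = 1
sameSide 𝔹 𝔹 = 1
sameSide _ _ = 0

count : ∀ {N} → (Fin N → Side) → Side → ℕ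
count {zero}  f s = 0
count {suc N} f s = sameSide (f Fin.zero) s ℕ.+ count (λ i → f (Fin.suc i)) s

ℕ→ℚ : ℕ → ℚ
ℕ→ℚ k = + k / 1

⅔ : ℚ
⅔ = + 2 / 3

record Separation {N : ℕ} (G : Graph N) (ε : ℚ) : Set where
  field
    side   : Fin N → Side
    A-lb   : 1 ℕ.≤ count side 𝔸
    A-ub   : ℕ→ℚ (count side 𝔸) ≤ ε ℚ.* ℕ→ℚ N
    B-lb   : 1 ℕ.≤ count side 𝔹
    B-ub   : ℕ→ℚ (count side 𝔹) ≤ ε ℚ.* ℕ→ℚ N
    noEdge : ∀ x y → side x ≡ 𝔸 → side y ≡ 𝔹 → ¬ E G x y
open Separation public

order : ∀ {N} {G : Graph N} {ε : ℚ} → Separation G ε → ℕ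
order s = count (side s) 𝕊

⅔≤⇒nonZero : ∀ {β} → ⅔ ≤ β → ℚ.NonZero β
⅔≤⇒nonZero h = ℚ.>-nonZero (ℚP.<-≤-trans (ℚ.*<* (Data.Integer.+<+ (ℕ.s≤s ℕ.z≤n))) h)

<1⇒nonZero : ∀ {β} → β < 1ℚ → ℚ.NonZero (1ℚ - β)
<1⇒nonZero {β} h = ℚ.>-nonZero (ℚP.+-monoʳ-< 1ℚ (ℚP.neg-antimono-< h))

{-# OPTIONS --safe #-}
module Submission where

-- Rows of the grid V(G) × V(H) are copies of G. A row meeting S in fewer than k
-- vertices restricts s to a partition of V(G) with no A–B edge and fewer than k
-- vertices in S; since every β-separation of G has order at least k and
-- βm + k ≤ m, one of its sides has at least βm vertices: the row is A-heavy or
-- B-heavy. If some row is A-heavy and some row is B-heavy, every column (a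
-- connected copy of H) meeting A in the first and B in the second meets S, so
-- |S| ≥ (2β - 1)m. Otherwise all thin rows are heavy on the same side X, so
-- every row satisfies kβm ≤ βm|S ∩ row| + k|X ∩ row|; summing over the n rows
-- and using |X| ≤ εmn gives (β - ε)kn ≤ β|S|.

open import Defs
open import Data.Nat using (ℕ; _+_; _*_; _≤_)
open import Data.Rational using (ℚ; 1ℚ; _-_; _÷_; 1/_) renaming (_≤_ to _≤ℚ_; _<_ to _<ℚ_; _*_ to _*ℚ_)

open import Data.Nat using (zero; suc; z≤n; s≤s; _<_; _≤?_; _≟_)
import Data.Nat.Properties as ℕ
open import Algebra.Properties.CommutativeSemigroup ℕ.+-commutativeSemigroup using (interchange; xy∙z≈xz∙y)
import Data.Integer as ℤ
import Data.Integer.Properties as ℤ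
open import Data.Nat.Coprimality using (1-coprimeTo) renaming (sym to coprime-sym)
open import Data.Rational as ℚ using (0ℚ; mkℚ; *≤*; Positive; positive) renaming (_+_ to _+ℚ_)
import Data.Rational.Properties as ℚ
open import Data.Rational.Solver renaming (module +-*-Solver to ℚ-Solver)
open import Data.Fin using (Fin; zero; suc; _↑ˡ_; _↑ʳ_; combine)
open import Data.Fin.Properties using (remQuot-combine; any?)
open import Algebra.Properties.CommutativeMonoid.Sum ℕ.+-0-commutativeMonoid using (sum-syntax; ∑-comm; sum-cong-≗)
open import Data.Product using (∃; _,_; proj₁; proj₂)
open import Data.Sum using (_⊎_; inj₁; inj₂; [_,_]′)
open import Data.Empty using (⊥-elim)
open import Relation.Nullary using (¬_; Dec; yes; no)
open import Function using (_∘_; id)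
open import Relation.Binary.PropositionalEquality using (_≡_; refl; sym; trans; cong; cong₂; subst; subst₂; module ≡-Reasoning)

-- In normal form ℕ→ℚ k has denominator 1, so ℚ's operations compute on numerators.
ℕ→ℚ≡mkℚ : ∀ k → ℕ→ℚ k ≡ mkℚ (ℤ.+ k) 0 (coprime-sym (1-coprimeTo k))
ℕ→ℚ≡mkℚ k = ℚ.normalize-coprime (coprime-sym (1-coprimeTo k))

ℕ→ℚ-homo-+ : ∀ a b → ℕ→ℚ (a + b) ≡ ℕ→ℚ a +ℚ ℕ→ℚ b
ℕ→ℚ-homo-+ a b = begin
  ℤ.+ (a + b) ℚ./ 1                                 ≡⟨ cong (ℚ._/ 1) (cong₂ ℤ._+_ (ℤ.*-identityʳ (ℤ.+ a)) (ℤ.*-identityʳ (ℤ.+ b))) ⟨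
  (ℤ.+ a ℤ.* ℤ.+ 1 ℤ.+ ℤ.+ b ℤ.* ℤ.+ 1) ℚ./ 1       ≡⟨ cong₂ _+ℚ_ (ℕ→ℚ≡mkℚ a) (ℕ→ℚ≡mkℚ b) ⟨
  ℕ→ℚ a +ℚ ℕ→ℚ b                                    ∎
  where open ≡-Reasoning

ℕ→ℚ-homo-* : ∀ a b → ℕ→ℚ (a * b) ≡ ℕ→ℚ a *ℚ ℕ→ℚ b
ℕ→ℚ-homo-* a b = begin
  ℤ.+ (a * b) ℚ./ 1             ≡⟨ cong (ℚ._/ 1) (ℤ.pos-* a b) ⟩
  (ℤ.+ a ℤ.* ℤ.+ b) ℚ./ 1       ≡⟨ cong₂ _*ℚ_ (ℕ→ℚ≡mkℚ a) (ℕ→ℚ≡mkℚ b) ⟨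
  ℕ→ℚ a *ℚ ℕ→ℚ b                ∎
  where open ≡-Reasoning

ℕ→ℚ-mono-≤ : ∀ {a b} → a ≤ b → ℕ→ℚ a ≤ℚ ℕ→ℚ b
ℕ→ℚ-mono-≤ {a} {b} a≤b rewrite ℕ→ℚ≡mkℚ a | ℕ→ℚ≡mkℚ b = *≤* (ℤ.*-monoʳ-≤-nonNeg (ℤ.+ 1) (ℤ.+≤+ a≤b))

0≤ℕ→ℚ : ∀ k → 0ℚ ≤ℚ ℕ→ℚ k
0≤ℕ→ℚ k = ℕ→ℚ-mono-≤ {0} {k} z≤n

p≤q⇒0≤q-p : ∀ {p q} → p ≤ℚ q → 0ℚ ≤ℚ q - p
p≤q⇒0≤q-p {p} {q} p≤q = subst (_≤ℚ q - p) (ℚ.+-inverseʳ p) (ℚ.+-monoˡ-≤ (ℚ.- p) p≤q)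

0≤q-p⇒p≤q : ∀ {p q} → 0ℚ ≤ℚ q - p → p ≤ℚ q
0≤q-p⇒p≤q {p} {q} 0≤q-p = subst₂ _≤ℚ_ (ℚ.+-identityˡ p) (q-p+p≡q p q) (ℚ.+-monoˡ-≤ p 0≤q-p)
  where
  open ℚ-Solver
  q-p+p≡q : ∀ p q → (q - p) +ℚ p ≡ q
  q-p+p≡q = solve 2 (λ p q → (q :- p) :+ p := q) refl

-- Linear inequalities between rational expressions are proved by writing the
-- difference of the two sides as a sum of products of nonnegative terms; the
-- identity itself is left to the ring solver.
≤-byCertificate : ∀ {p q d} → d ≡ q - p → 0ℚ ≤ℚ d → p ≤ℚ q
≤-byCertificate refl = 0≤q-p⇒p≤q

+-nonNeg : ∀ {p q} → 0ℚ ≤ℚ p → 0ℚ ≤ℚ q → 0ℚ ≤ℚ p +ℚ q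
+-nonNeg = ℚ.+-mono-≤

*-nonNeg : ∀ {p q} → 0ℚ ≤ℚ p → 0ℚ ≤ℚ q → 0ℚ ≤ℚ p *ℚ q
*-nonNeg {p} {q} 0≤p 0≤q =
  ℚ.nonNegative⁻¹ _ {{ℚ.nonNeg*nonNeg⇒nonNeg p {{ℚ.nonNegative 0≤p}} q {{ℚ.nonNegative 0≤q}}}}

0<⅔ : 0ℚ <ℚ ⅔
0<⅔ = ℚ.positive⁻¹ ⅔

⅔≤⇒0≤ : ∀ {p} → ⅔ ≤ℚ p → 0ℚ ≤ℚ p
⅔≤⇒0≤ = ℚ.≤-trans (ℚ.<⇒≤ 0<⅔)

[β-ε]x≤βy⇒[1-ε÷β]x≤y : ∀ {β ε x y} .{{_ : Positive β}} →
                        (β - ε) *ℚ x ≤ℚ β *ℚ y → (1ℚ - (ε ÷ β) {{ℚ.pos⇒nonZero β}}) *ℚ x ≤ℚ y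
[β-ε]x≤βy⇒[1-ε÷β]x≤y {β} {ε} {x} {y} h = ℚ.*-cancelˡ-≤-pos β (subst (_≤ℚ β *ℚ y) (sym β[1-ε÷β]x≡[β-ε]x) h)
  where
  open ℚ-Solver
  instance
    β≢0 : ℚ.NonZero β
    β≢0 = ℚ.pos⇒nonZero β
  β[1-ε÷β]x≡[β-ε]x : β *ℚ ((1ℚ - ε ÷ β) *ℚ x) ≡ (β - ε) *ℚ x
  β[1-ε÷β]x≡[β-ε]x = begin
    β *ℚ ((1ℚ - ε *ℚ 1/ β) *ℚ x)    ≡⟨ solve 4 (λ β ε i x → β :* ((con 1ℚ :- ε :* i) :* x) := (β :- ε :* (β :* i)) :* x)
                                               refl β ε (1/ β) x ⟩
    (β - ε *ℚ (β *ℚ 1/ β)) *ℚ x     ≡⟨ cong (λ t → (β - ε *ℚ t) *ℚ x) (ℚ.*-inverseʳ β) ⟩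
    (β - ε *ℚ 1ℚ) *ℚ x              ≡⟨ cong (λ t → (β - t) *ℚ x) (ℚ.*-identityʳ ε) ⟩
    (β - ε) *ℚ x                    ∎
    where open ≡-Reasoning

βm+k≤m : ∀ {β k n m} (β<1 : β <ℚ 1ℚ) → (1/ (1ℚ - β)) {{<1⇒nonZero β<1}} ≤ℚ ℕ→ℚ n → k * n ≤ m →
         β *ℚ ℕ→ℚ m +ℚ ℕ→ℚ k ≤ℚ ℕ→ℚ m
βm+k≤m {β} {k} {n} {m} β<1 1/[1-β]≤n kn≤m =
  ≤-byCertificate (certificate β (ℕ→ℚ m) (ℕ→ℚ k) (ℕ→ℚ n))
    (+-nonNeg (*-nonNeg 0≤1-β (p≤q⇒0≤q-p kn≤m′)) (*-nonNeg (0≤ℕ→ℚ k) (p≤q⇒0≤q-p 1≤[1-β]n)))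
  where
  0≤1-β : 0ℚ ≤ℚ 1ℚ - β
  0≤1-β = p≤q⇒0≤q-p (ℚ.<⇒≤ β<1)
  kn≤m′ : ℕ→ℚ k *ℚ ℕ→ℚ n ≤ℚ ℕ→ℚ m
  kn≤m′ = subst (_≤ℚ ℕ→ℚ m) (ℕ→ℚ-homo-* k n) (ℕ→ℚ-mono-≤ kn≤m)
  1≤[1-β]n : 1ℚ ≤ℚ (1ℚ - β) *ℚ ℕ→ℚ n
  1≤[1-β]n = subst (_≤ℚ (1ℚ - β) *ℚ ℕ→ℚ n) (ℚ.*-inverseʳ (1ℚ - β) {{<1⇒nonZero β<1}})
               (ℚ.*-monoˡ-≤-nonNeg (1ℚ - β) {{ℚ.nonNegative 0≤1-β}} 1/[1-β]≤n)
  open ℚ-Solver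
  certificate : ∀ β M K N → (1ℚ - β) *ℚ (M - K *ℚ N) +ℚ K *ℚ ((1ℚ - β) *ℚ N - 1ℚ) ≡ M - (β *ℚ M +ℚ K)
  certificate = solve 4 (λ β M K N → (con 1ℚ :- β) :* (M :- K :* N) :+ K :* ((con 1ℚ :- β) :* N :- con 1ℚ)
                                     := M :- (β :* M :+ K)) refl

two-heavy-rows-bound : ∀ {β ε} (a b s : ℕ) {m kn : ℕ} → ⅔ ≤ℚ β → ⅔ ≤ℚ ε → β <ℚ 1ℚ → ε <ℚ β → kn ≤ m →
                       a + b ≤ m + s → β *ℚ ℕ→ℚ m ≤ℚ ℕ→ℚ a → β *ℚ ℕ→ℚ m ≤ℚ ℕ→ℚ b →
                       (β - ε) *ℚ ℕ→ℚ kn ≤ℚ β *ℚ ℕ→ℚ s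
two-heavy-rows-bound {β} {ε} a b s {m} {kn} ⅔≤β ⅔≤ε β<1 ε<β kn≤m a+b≤m+s βm≤a βm≤b =
  ≤-byCertificate (certificate β ε (ℕ→ℚ a) (ℕ→ℚ b) (ℕ→ℚ s) (ℕ→ℚ m) (ℕ→ℚ kn))
    (+-nonNeg (+-nonNeg
      (*-nonNeg (⅔≤⇒0≤ ⅔≤β) (+-nonNeg (+-nonNeg (p≤q⇒0≤q-p βm≤a) (p≤q⇒0≤q-p βm≤b)) (p≤q⇒0≤q-p a+b≤m+s′)))
      (*-nonNeg (+-nonNeg (+-nonNeg (+-nonNeg (*-nonNeg 0≤1-β 0≤1-β) (*-nonNeg 0≤1-β 0≤1-β)) (+-nonNeg 0≤β-⅔ 0≤β-⅔)) 0≤ε-⅔)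
                (0≤ℕ→ℚ m)))
      (*-nonNeg (p≤q⇒0≤q-p (ℚ.<⇒≤ ε<β)) (p≤q⇒0≤q-p (ℕ→ℚ-mono-≤ kn≤m))))
  where
  0≤1-β : 0ℚ ≤ℚ 1ℚ - β
  0≤1-β = p≤q⇒0≤q-p (ℚ.<⇒≤ β<1)
  0≤β-⅔ : 0ℚ ≤ℚ β - ⅔
  0≤β-⅔ = p≤q⇒0≤q-p ⅔≤β
  0≤ε-⅔ : 0ℚ ≤ℚ ε - ⅔
  0≤ε-⅔ = p≤q⇒0≤q-p ⅔≤ε
  a+b≤m+s′ : ℕ→ℚ a +ℚ ℕ→ℚ b ≤ℚ ℕ→ℚ m +ℚ ℕ→ℚ s
  a+b≤m+s′ = subst₂ _≤ℚ_ (ℕ→ℚ-homo-+ a b) (ℕ→ℚ-homo-+ m s) (ℕ→ℚ-mono-≤ a+b≤m+s)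
  open ℚ-Solver
  -- β(2β - 1) - (β - ε) = 2(1 - β)² + 2(β - ⅔) + (ε - ⅔) is where ⅔ ≤ β, ε enters.
  certificate : ∀ β ε A B S M KN →
    β *ℚ ((A - β *ℚ M) +ℚ (B - β *ℚ M) +ℚ ((M +ℚ S) - (A +ℚ B)))
      +ℚ (((1ℚ - β) *ℚ (1ℚ - β) +ℚ (1ℚ - β) *ℚ (1ℚ - β)) +ℚ ((β - ⅔) +ℚ (β - ⅔)) +ℚ (ε - ⅔)) *ℚ M
      +ℚ (β - ε) *ℚ (M - KN)
    ≡ β *ℚ S - (β - ε) *ℚ KN
  certificate = solve 7 (λ β ε A B S M KN →
    β :* ((A :- β :* M) :+ (B :- β :* M) :+ ((M :+ S) :- (A :+ B)))
      :+ (((con 1ℚ :- β) :* (con 1ℚ :- β) :+ (con 1ℚ :- β) :* (con 1ℚ :- β)) :+ ((β :- con ⅔) :+ (β :- con ⅔)) :+ (ε :- con ⅔)) :* M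
      :+ (β :- ε) :* (M :- KN)
    := β :* S :- (β :- ε) :* KN) refl

∑-lowerBound : ∀ {N} (a b c : ℚ) (f g : Fin N → ℕ) →
               (∀ i → c ≤ℚ a *ℚ ℕ→ℚ (f i) +ℚ b *ℚ ℕ→ℚ (g i)) →
               ℕ→ℚ N *ℚ c ≤ℚ a *ℚ ℕ→ℚ (∑[ i < N ] f i) +ℚ b *ℚ ℕ→ℚ (∑[ i < N ] g i)
∑-lowerBound {zero} a b c f g _ =
  ℚ.≤-reflexive (trans (ℚ.*-zeroˡ c) (sym (cong₂ _+ℚ_ (ℚ.*-zeroʳ a) (ℚ.*-zeroʳ b))))
∑-lowerBound {suc N} a b c f g bound =
  ≤-byCertificate certificate (+-nonNeg (p≤q⇒0≤q-p (bound zero)) (p≤q⇒0≤q-p (∑-lowerBound a b c (f ∘ suc) (g ∘ suc) (bound ∘ suc))))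
  where
  f₀ g₀ F G : ℚ
  f₀ = ℕ→ℚ (f zero)
  g₀ = ℕ→ℚ (g zero)
  F = ℕ→ℚ (∑[ i < N ] f (suc i))
  G = ℕ→ℚ (∑[ i < N ] g (suc i))
  open ℚ-Solver
  certificate : (a *ℚ f₀ +ℚ b *ℚ g₀ - c) +ℚ (a *ℚ F +ℚ b *ℚ G - ℕ→ℚ N *ℚ c)
              ≡ a *ℚ ℕ→ℚ (f zero + ∑[ i < N ] f (suc i)) +ℚ b *ℚ ℕ→ℚ (g zero + ∑[ i < N ] g (suc i)) - ℕ→ℚ (1 + N) *ℚ c
  certificate rewrite ℕ→ℚ-homo-+ (f zero) (∑[ i < N ] f (suc i)) | ℕ→ℚ-homo-+ (g zero) (∑[ i < N ] g (suc i)) | ℕ→ℚ-homo-+ 1 N =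
    solve 8 (λ a b c f₀ g₀ F G N → (a :* f₀ :+ b :* g₀ :- c) :+ (a :* F :+ b :* G :- N :* c)
                                   := a :* (f₀ :+ F) :+ b :* (g₀ :+ G) :- (con 1ℚ :+ N) :* c) refl a b c f₀ g₀ F G (ℕ→ℚ N)

thin-rows-bound : ∀ {β ε} {k n m s x : ℕ} {S X : Fin n → ℕ} → ⅔ ≤ℚ β → 1 ≤ m →
                  ∑[ v < n ] S v ≡ s → ∑[ v < n ] X v ≡ x →
                  (∀ v → S v < k → β *ℚ ℕ→ℚ m ≤ℚ ℕ→ℚ (X v)) → ℕ→ℚ x ≤ℚ ε *ℚ ℕ→ℚ (m * n) →
                  (β - ε) *ℚ ℕ→ℚ (k * n) ≤ℚ β *ℚ ℕ→ℚ s
thin-rows-bound {β} {ε} {k} {n} {m} {s} {x} {S} {X} ⅔≤β 1≤m refl refl thin⇒heavy x≤εmn =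
  subst (λ t → (β - ε) *ℚ t ≤ℚ β *ℚ ℕ→ℚ s) (sym (ℕ→ℚ-homo-* k n))
    (ℚ.*-cancelˡ-≤-pos M (≤-byCertificate (certificate β ε M K N (ℕ→ℚ s) (ℕ→ℚ x))
      (+-nonNeg (p≤q⇒0≤q-p summed) (*-nonNeg (0≤ℕ→ℚ k) (p≤q⇒0≤q-p x≤εMN)))))
  where
  M K N : ℚ
  M = ℕ→ℚ m
  K = ℕ→ℚ k
  N = ℕ→ℚ n
  instance
    M>0 : Positive M
    M>0 = positive (ℚ.<-≤-trans (ℚ.positive⁻¹ 1ℚ) (ℕ→ℚ-mono-≤ 1≤m))
  0≤βM : 0ℚ ≤ℚ β *ℚ M
  0≤βM = *-nonNeg (⅔≤⇒0≤ ⅔≤β) (0≤ℕ→ℚ m)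
  x≤εMN : ℕ→ℚ x ≤ℚ ε *ℚ (M *ℚ N)
  x≤εMN = subst (λ t → ℕ→ℚ x ≤ℚ ε *ℚ t) (ℕ→ℚ-homo-* m n) x≤εmn
  open ℚ-Solver
  row-bound : ∀ v → K *ℚ (β *ℚ M) ≤ℚ (β *ℚ M) *ℚ ℕ→ℚ (S v) +ℚ K *ℚ ℕ→ℚ (X v)
  row-bound v with k ≤? S v
  ... | yes k≤S = ≤-byCertificate (thick (β *ℚ M) K (ℕ→ℚ (S v)) (ℕ→ℚ (X v)))
                    (+-nonNeg (*-nonNeg 0≤βM (p≤q⇒0≤q-p (ℕ→ℚ-mono-≤ k≤S))) (*-nonNeg (0≤ℕ→ℚ k) (0≤ℕ→ℚ (X v))))
    where
    thick : ∀ B K S X → B *ℚ (S - K) +ℚ K *ℚ X ≡ (B *ℚ S +ℚ K *ℚ X) - K *ℚ B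
    thick = solve 4 (λ B K S X → B :* (S :- K) :+ K :* X := (B :* S :+ K :* X) :- K :* B) refl
  ... | no k≰S = ≤-byCertificate (thin (β *ℚ M) K (ℕ→ℚ (S v)) (ℕ→ℚ (X v)))
                   (+-nonNeg (*-nonNeg 0≤βM (0≤ℕ→ℚ (S v))) (*-nonNeg (0≤ℕ→ℚ k) (p≤q⇒0≤q-p (thin⇒heavy v (ℕ.≰⇒> k≰S)))))
    where
    thin : ∀ B K S X → B *ℚ S +ℚ K *ℚ (X - B) ≡ (B *ℚ S +ℚ K *ℚ X) - K *ℚ B
    thin = solve 4 (λ B K S X → B :* S :+ K :* (X :- B) := (B :* S :+ K :* X) :- K :* B) refl
  summed : N *ℚ (K *ℚ (β *ℚ M)) ≤ℚ (β *ℚ M) *ℚ ℕ→ℚ s +ℚ K *ℚ ℕ→ℚ x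
  summed = ∑-lowerBound (β *ℚ M) K (K *ℚ (β *ℚ M)) S X row-bound
  certificate : ∀ β ε M K N s x →
    ((β *ℚ M) *ℚ s +ℚ K *ℚ x - N *ℚ (K *ℚ (β *ℚ M))) +ℚ K *ℚ (ε *ℚ (M *ℚ N) - x)
    ≡ M *ℚ (β *ℚ s) - M *ℚ ((β - ε) *ℚ (K *ℚ N))
  certificate = solve 7 (λ β ε M K N s x →
    ((β :* M) :* s :+ K :* x :- N :* (K :* (β :* M))) :+ K :* (ε :* (M :* N) :- x)
    := M :* (β :* s) :- M :* ((β :- ε) :* (K :* N))) refl

sameSide-refl : ∀ X → sameSide X X ≡ 1
sameSide-refl 𝔸 = refl
sameSide-refl 𝕊 = refl
sameSide-refl 𝔹 = refl

sameSide-partition : ∀ X → sameSide X 𝔸 + sameSide X 𝕊 + sameSide X 𝔹 ≡ 1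
sameSide-partition 𝔸 = refl
sameSide-partition 𝕊 = refl
sameSide-partition 𝔹 = refl

count-partition : ∀ {N} (f : Fin N → Side) → count f 𝔸 + count f 𝕊 + count f 𝔹 ≡ N
count-partition {zero} f = refl
count-partition {suc N} f = begin
  (a + A) + (s + S) + (b + B)  ≡⟨ cong (_+ (b + B)) (interchange a A s S) ⟩
  (a + s) + (A + S) + (b + B)  ≡⟨ interchange (a + s) (A + S) b B ⟩
  (a + s + b) + (A + S + B)    ≡⟨ cong₂ _+_ (sameSide-partition (f zero)) (count-partition (f ∘ suc)) ⟩
  1 + N                        ∎
  where
  open ≡-Reasoning
  a s b A S B : ℕ
  a = sameSide (f zero) 𝔸
  s = sameSide (f zero) 𝕊
  b = sameSide (f zero) 𝔹
  A = count (f ∘ suc) 𝔸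
  S = count (f ∘ suc) 𝕊
  B = count (f ∘ suc) 𝔹

count-pos : ∀ {N} (f : Fin N → Side) {X} i → f i ≡ X → 1 ≤ count f X
count-pos f {X} zero refl = ℕ.≤-trans (ℕ.≤-reflexive (sym (sameSide-refl X))) (ℕ.m≤m+n _ _)
count-pos f (suc i) fi≡X = ℕ.≤-trans (count-pos (f ∘ suc) i fi≡X) (ℕ.m≤n+m _ _)

count≡∑ : ∀ {N} (f : Fin N → Side) X → count f X ≡ ∑[ i < N ] sameSide (f i) X
count≡∑ {zero} f X = refl
count≡∑ {suc N} f X = cong (sameSide (f zero) X +_) (count≡∑ (f ∘ suc) X)

count-↑ : ∀ n {k} (f : Fin (n + k) → Side) X → count f X ≡ count (f ∘ (_↑ˡ k)) X + count (f ∘ (n ↑ʳ_)) X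
count-↑ zero f X = refl
count-↑ (suc n) {k} f X =
  trans (cong (sameSide (f zero) X +_) (count-↑ n (f ∘ suc) X))
        (sym (ℕ.+-assoc (sameSide (f zero) X) (count (f ∘ suc ∘ (_↑ˡ k)) X) (count (f ∘ suc ∘ (n ↑ʳ_)) X)))

count-combine : ∀ m {n} (f : Fin (m * n) → Side) X → count f X ≡ ∑[ a < m ] count (λ v → f (combine a v)) X
count-combine zero f X = refl
count-combine (suc m) {n} f X =
  trans (count-↑ n f X) (cong (count (f ∘ (_↑ˡ (m * n))) X +_) (count-combine m (f ∘ (n ↑ʳ_)) X))

count𝔸+count𝔹≤N+∑ : ∀ {N} (f g : Fin N → Side) (h : Fin N → ℕ) → (∀ i → f i ≡ 𝔸 → g i ≡ 𝔹 → 1 ≤ h i) →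
                    count f 𝔸 + count g 𝔹 ≤ N + ∑[ i < N ] h i
count𝔸+count𝔹≤N+∑ {zero} f g h _ = z≤n
count𝔸+count𝔹≤N+∑ {suc N} f g h crossing = begin
  (a₀ + A) + (b₀ + B)            ≡⟨ interchange a₀ A b₀ B ⟩
  (a₀ + b₀) + (A + B)            ≤⟨ ℕ.+-mono-≤ (pointwise (f zero) (g zero) (crossing zero))
                                               (count𝔸+count𝔹≤N+∑ (f ∘ suc) (g ∘ suc) (h ∘ suc) (crossing ∘ suc)) ⟩
  (1 + h zero) + (N + ∑[ i < N ] h (suc i)) ≡⟨ interchange 1 (h zero) N _ ⟩
  suc N + ∑[ i < suc N ] h i     ∎
  where
  open ℕ.≤-Reasoning
  a₀ b₀ A B : ℕ
  a₀ = sameSide (f zero) 𝔸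
  b₀ = sameSide (g zero) 𝔹
  A = count (f ∘ suc) 𝔸
  B = count (g ∘ suc) 𝔹
  pointwise : ∀ x y {c} → (x ≡ 𝔸 → y ≡ 𝔹 → 1 ≤ c) → sameSide x 𝔸 + sameSide y 𝔹 ≤ 1 + c
  pointwise 𝔸 𝔹 cross = s≤s (cross refl refl)
  pointwise 𝔸 𝔸 _ = s≤s z≤n
  pointwise 𝔸 𝕊 _ = s≤s z≤n
  pointwise 𝕊 𝔹 _ = s≤s z≤n
  pointwise 𝔹 𝔹 _ = s≤s z≤n
  pointwise 𝕊 𝔸 _ = z≤n
  pointwise 𝕊 𝕊 _ = z≤n
  pointwise 𝔹 𝔸 _ = z≤n
  pointwise 𝔹 𝕊 _ = z≤n

Separating : ∀ {N} → Graph N → (Fin N → Side) → Set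
Separating G ℓ = ∀ x y → ℓ x ≡ 𝔸 → ℓ y ≡ 𝔹 → ¬ E G x y

walk-meets-𝕊 : ∀ {N} {G : Graph N} {ℓ} → Separating G ℓ →
               ∀ {x y} → Walk G x y → ℓ x ≡ 𝔸 → ℓ y ≡ 𝔹 → ∃ λ z → ℓ z ≡ 𝕊
walk-meets-𝕊 sep here ℓx≡𝔸 ℓx≡𝔹 with () ← trans (sym ℓx≡𝔸) ℓx≡𝔹
walk-meets-𝕊 {ℓ = ℓ} sep {x} (step {w = z} x~z walk) ℓx≡𝔸 ℓy≡𝔹 with ℓ z in ℓz≡
... | 𝔸 = walk-meets-𝕊 sep walk ℓz≡ ℓy≡𝔹
... | 𝕊 = z , ℓz≡
... | 𝔹 = ⊥-elim (sep x z ℓx≡𝔸 ℓz≡ x~z)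

connected⇒1≤count𝕊 : ∀ {N} {G : Graph N} {ℓ} → Connected G → Separating G ℓ →
                     ∀ {x y} → ℓ x ≡ 𝔸 → ℓ y ≡ 𝔹 → 1 ≤ count ℓ 𝕊
connected⇒1≤count𝕊 {ℓ = ℓ} conn sep {x} {y} ℓx≡𝔸 ℓy≡𝔹 =
  let z , ℓz≡𝕊 = walk-meets-𝕊 sep (conn x y) ℓx≡𝔸 ℓy≡𝔹 in count-pos ℓ z ℓz≡𝕊

□-edgeˡ : ∀ {m n} {G : Graph m} (H : Graph n) {a b} v → E G a b → E (G □ H) (combine a v) (combine b v)
□-edgeˡ {G = G} H {a} {b} v a~b =
  inj₁ ( subst₂ (E G) (cong proj₁ (sym (remQuot-combine a v))) (cong proj₁ (sym (remQuot-combine b v))) a~b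
       , trans (cong proj₂ (remQuot-combine a v)) (cong proj₂ (sym (remQuot-combine b v))))

□-edgeʳ : ∀ {m n} (G : Graph m) {H : Graph n} a {v w} → E H v w → E (G □ H) (combine a v) (combine a w)
□-edgeʳ G {H} a {v} {w} v~w =
  inj₂ ( subst₂ (E H) (cong proj₂ (sym (remQuot-combine a v))) (cong proj₂ (sym (remQuot-combine a w))) v~w
       , trans (cong proj₁ (remQuot-combine a v)) (cong proj₁ (sym (remQuot-combine a w))))

module Grid {m n : ℕ} (ℓ : Fin (m * n) → Side) where

  row : Fin n → Fin m → Side
  row v a = ℓ (combine a v)

  column : Fin m → Fin n → Side
  column a v = ℓ (combine a v)

  count-by-columns : ∀ X → count ℓ X ≡ ∑[ a < m ] count (column a) X
  count-by-columns = count-combine m {n} ℓ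

  count-by-rows : ∀ X → count ℓ X ≡ ∑[ v < n ] count (row v) X
  count-by-rows X = begin
    count ℓ X                                     ≡⟨ count-by-columns X ⟩
    ∑[ a < m ] count (column a) X                 ≡⟨ sum-cong-≗ (λ a → count≡∑ (column a) X) ⟩
    ∑[ a < m ] ∑[ v < n ] sameSide (ℓ (combine a v)) X  ≡⟨ ∑-comm {m} {n} (λ a v → sameSide (ℓ (combine a v)) X) ⟩
    ∑[ v < n ] ∑[ a < m ] sameSide (ℓ (combine a v)) X  ≡⟨ sum-cong-≗ (λ v → count≡∑ (row v) X) ⟨
    ∑[ v < n ] count (row v) X                    ∎
    where open ≡-Reasoning

  module _ {G : Graph m} {H : Graph n} (sep : Separating (G □ H) ℓ) where

    row-separating : ∀ v → Separating G (row v)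
    row-separating v a b ℓa≡𝔸 ℓb≡𝔹 a~b = sep _ _ ℓa≡𝔸 ℓb≡𝔹 (□-edgeˡ {G = G} H v a~b)

    column-separating : ∀ a → Separating H (column a)
    column-separating a v w ℓv≡𝔸 ℓw≡𝔹 v~w = sep _ _ ℓv≡𝔸 ℓw≡𝔹 (□-edgeʳ G {H} a v~w)

    -- Every column meeting A in row v and B in row w contains a vertex of S.
    count𝔸-row+count𝔹-row≤m+count𝕊 : Connected H → ∀ v w → count (row v) 𝔸 + count (row w) 𝔹 ≤ m + count ℓ 𝕊
    count𝔸-row+count𝔹-row≤m+count𝕊 H-conn v w =
      subst (λ t → count (row v) 𝔸 + count (row w) 𝔹 ≤ m + t) (sym (count-by-columns 𝕊))
        (count𝔸+count𝔹≤N+∑ (row v) (row w) (λ a → count (column a) 𝕊)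
          (λ a → connected⇒1≤count𝕊 H-conn (column-separating a)))

large-side : ∀ {m} {G : Graph m} {β k} → ((s : Separation G β) → k ≤ order s) →
             β *ℚ ℕ→ℚ m +ℚ ℕ→ℚ k ≤ℚ ℕ→ℚ m →
             ∀ {ℓ} → Separating G ℓ → count ℓ 𝕊 < k →
             β *ℚ ℕ→ℚ m ≤ℚ ℕ→ℚ (count ℓ 𝔸) ⊎ β *ℚ ℕ→ℚ m ≤ℚ ℕ→ℚ (count ℓ 𝔹)
large-side {m} {G} {β} {k} G-sep βm+k≤m {ℓ} sep few-𝕊 = by-emptiness (count ℓ 𝔸 ≟ 0) (count ℓ 𝔹 ≟ 0)
  where
  A B : ℕ
  A = count ℓ 𝔸
  B = count ℓ 𝔹
  βm : ℚ
  βm = β *ℚ ℕ→ℚ m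

  m≤A+B+k : m ≤ A + B + k
  m≤A+B+k = begin
    m                  ≡⟨ count-partition ℓ ⟨
    A + count ℓ 𝕊 + B  ≡⟨ xy∙z≈xz∙y A (count ℓ 𝕊) B ⟩
    A + B + count ℓ 𝕊  ≤⟨ ℕ.+-monoʳ-≤ (A + B) (ℕ.<⇒≤ few-𝕊) ⟩
    A + B + k          ∎
    where open ℕ.≤-Reasoning

  heavy : ∀ {c} → m ≤ c + k → βm ≤ℚ ℕ→ℚ c
  heavy {c} m≤c+k = ≤-byCertificate (certificate βm (ℕ→ℚ m) (ℕ→ℚ k) (ℕ→ℚ c))
    (+-nonNeg (p≤q⇒0≤q-p βm+k≤m) (p≤q⇒0≤q-p (subst (ℕ→ℚ m ≤ℚ_) (ℕ→ℚ-homo-+ c k) (ℕ→ℚ-mono-≤ m≤c+k))))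
    where
    open ℚ-Solver
    certificate : ∀ βm M K C → (M - (βm +ℚ K)) +ℚ ((C +ℚ K) - M) ≡ C - βm
    certificate = solve 4 (λ βm M K C → (M :- (βm :+ K)) :+ ((C :+ K) :- M) := C :- βm) refl

  by-size : Dec (ℕ→ℚ A ≤ℚ βm) → Dec (ℕ→ℚ B ≤ℚ βm) → 1 ≤ A → 1 ≤ B → βm ≤ℚ ℕ→ℚ A ⊎ βm ≤ℚ ℕ→ℚ B
  by-size (no A≰βm) _ _ _ = inj₁ (ℚ.<⇒≤ (ℚ.≰⇒> A≰βm))
  by-size _ (no B≰βm) _ _ = inj₂ (ℚ.<⇒≤ (ℚ.≰⇒> B≰βm))
  by-size (yes A≤βm) (yes B≤βm) 1≤A 1≤B = ⊥-elim (ℕ.<⇒≱ few-𝕊 (G-sep small-separation))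
    where
    small-separation : Separation G β
    small-separation = record
      { side = ℓ ; A-lb = 1≤A ; A-ub = A≤βm ; B-lb = 1≤B ; B-ub = B≤βm ; noEdge = sep }

  by-emptiness : Dec (A ≡ 0) → Dec (B ≡ 0) → βm ≤ℚ ℕ→ℚ A ⊎ βm ≤ℚ ℕ→ℚ B
  by-emptiness (yes A≡0) _ = inj₂ (heavy (subst (λ a → m ≤ a + B + k) A≡0 m≤A+B+k))
  by-emptiness _ (yes B≡0) =
    inj₁ (heavy (subst (λ t → m ≤ t + k) (ℕ.+-identityʳ A) (subst (λ b → m ≤ A + b + k) B≡0 m≤A+B+k)))
  by-emptiness (no A≢0) (no B≢0) =
    by-size (ℕ→ℚ A ℚ.≤? βm) (ℕ→ℚ B ℚ.≤? βm) (ℕ.n≢0⇒n>0 A≢0) (ℕ.n≢0⇒n>0 B≢0)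

lemma24 : (ε β : ℚ) → ⅔ ≤ℚ ε → ε <ℚ 1ℚ → (hβ : ⅔ ≤ℚ β) → (hβ1 : β <ℚ 1ℚ) → ε <ℚ β →
          (k n m : ℕ) → 1 ≤ k → 1 ≤ n → 1 ≤ m → k * n ≤ m →
          (1/ (1ℚ - β)) {{<1⇒nonZero hβ1}} ≤ℚ ℕ→ℚ n →
          (G : Graph m) (H : Graph n) → Connected G → Connected H →
          ((s : Separation G β) → k ≤ order s) →
          (s : Separation (G □ H) ε) →
          (1ℚ - (ε ÷ β) {{⅔≤⇒nonZero hβ}}) *ℚ ℕ→ℚ (k * n) ≤ℚ ℕ→ℚ (order s)
lemma24 ε β ⅔≤ε _ ⅔≤β β<1 ε<β k n m _ _ 1≤m kn≤m 1/[1-β]≤n G H _ H-conn G-sep s =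
  [β-ε]x≤βy⇒[1-ε÷β]x≤y {β} {ε} (by-heavy-rows (any? (heavy? 𝔸)) (any? (heavy? 𝔹)))
  where
  open Grid {m} {n} (side s)
  instance
    β>0 : Positive β
    β>0 = positive (ℚ.<-≤-trans 0<⅔ ⅔≤β)

  Heavy : Side → Fin n → Set
  Heavy X v = β *ℚ ℕ→ℚ m ≤ℚ ℕ→ℚ (count (row v) X)

  heavy? : ∀ X v → Dec (Heavy X v)
  heavy? X v = β *ℚ ℕ→ℚ m ℚ.≤? ℕ→ℚ (count (row v) X)

  thin⇒heavy : ∀ v → count (row v) 𝕊 < k → Heavy 𝔸 v ⊎ Heavy 𝔹 v
  thin⇒heavy v = large-side G-sep (βm+k≤m {k = k} {n} β<1 1/[1-β]≤n kn≤m) (row-separating {G = G} {H} (noEdge s) v)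

  thin-rows : ∀ X → (∀ v → count (row v) 𝕊 < k → Heavy X v) → ℕ→ℚ (count (side s) X) ≤ℚ ε *ℚ ℕ→ℚ (m * n) →
              (β - ε) *ℚ ℕ→ℚ (k * n) ≤ℚ β *ℚ ℕ→ℚ (order s)
  thin-rows X = thin-rows-bound {β} {ε} ⅔≤β 1≤m (sym (count-by-rows 𝕊)) (sym (count-by-rows X))

  by-heavy-rows : Dec (∃ (Heavy 𝔸)) → Dec (∃ (Heavy 𝔹)) → (β - ε) *ℚ ℕ→ℚ (k * n) ≤ℚ β *ℚ ℕ→ℚ (order s)
  by-heavy-rows (yes (v , 𝔸-heavy)) (yes (w , 𝔹-heavy)) =
    two-heavy-rows-bound (count (row v) 𝔸) (count (row w) 𝔹) (order s) ⅔≤β ⅔≤ε β<1 ε<β kn≤m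
      (count𝔸-row+count𝔹-row≤m+count𝕊 {G = G} (noEdge s) H-conn v w) 𝔸-heavy 𝔹-heavy
  by-heavy-rows (no no-𝔸-heavy) _ =
    thin-rows 𝔹 (λ v thin → [ ⊥-elim ∘ no-𝔸-heavy ∘ (v ,_) , id ]′ (thin⇒heavy v thin)) (B-ub s)
  by-heavy-rows _ (no no-𝔹-heavy) =
    thin-rows 𝔸 (λ v thin → [ id , ⊥-elim ∘ no-𝔹-heavy ∘ (v ,_) ]′ (thin⇒heavy v thin)) (A-ub s)
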